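{- Let $q_2=u_2+v_2i\in\mathbb{Z}[i]\setminus\{0\}$ and $r_2=x_2+y_2i\in\mathbb{Z}[i]$ with $r_2$ coprime to $q_2$, where $u_2,v_2,x_2,y_2\in\mathbb{Z}$, and set $k:=x_2u_2+y_2v_2$ and $l:=x_2v_2-y_2u_2$. Let $u,v,\tilde{u},\tilde{v}\in\mathbb{Z}$. Then $$ \left|f\left(\frac{uk+vl}{\mathcal{N}(q_2)}\right)-f\left(\frac{\tilde{u}k+\tilde{v}l}{\mathcal{N}(q_2)}\right)\right|^2 +\left|f\left(\frac{ -vk+ul}{\mathcal{N}(q_2)}\right)-f\left(\frac{ -\tilde{v}k+\tilde{u}l}{\mathcal{N}(q_2)}\right)\right|^2 $$ is $\ge 1/\mathcal{N}(q_2)$ if $q_2\nmid (u-\tilde{u})+(v-\tilde{v})i$ in $\mathbb{Z}[i]$, and equals $0$ if $q_2\mid (u-\tilde{u})+(v-\tilde{v})i$.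
   Context: $\mathcal{N}(x)=x\overline{x}$ is the norm on $\mathbb{Z}[i]$. For real $z$, $f(z):=\{z+1/2\}-1/2$, where $\{\cdot\}$ denotes the fractional part. -}

module Defs where

open import Data.Nat using (ℕ; zero; suc)
open import Data.Integer as ℤ using (ℤ; +_)
open import Data.Rational as ℚ using (ℚ; 0ℚ; ½; floor)
open import Data.Product using (Σ; _×_; _,_)
open import Relation.Binary.PropositionalEquality using (_≡_)

record 𝔾 : Set where
  constructor _+_i
  field
    re : ℤ
    im : ℤ
open 𝔾 public

0𝔾 : 𝔾
0𝔾 = (+ 0) + (+ 0) i

1𝔾 : 𝔾
1𝔾 = (+ 1) + (+ 0) i

_*𝔾_ : 𝔾 → 𝔾 → 𝔾
(a + b i) *𝔾 (c + d i) = (a ℤ.* c ℤ.- b ℤ.* d) + (a ℤ.* d ℤ.+ b ℤ.* c) i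

_∣𝔾_ : 𝔾 → 𝔾 → Set
q ∣𝔾 a = Σ 𝔾 (λ c → q *𝔾 c ≡ a)

Coprime𝔾 : 𝔾 → 𝔾 → Set
Coprime𝔾 a b = (d : 𝔾) → d ∣𝔾 a → d ∣𝔾 b → d ∣𝔾 1𝔾

𝒩 : 𝔾 → ℤ
𝒩 (a + b i) = a ℤ.* a ℤ.+ b ℤ.* b

-- a / n as a rational; the value for n = 0 is junk (never used: q₂ ≠ 0)
_/ℕ_ : ℤ → ℕ → ℚ
a /ℕ zero = 0ℚ
a /ℕ suc n = a ℚ./ suc n

-- a / 𝒩(q)  (𝒩(q) ≥ 0, so ∣𝒩 q∣ = 𝒩 q)
_/𝒩_ : ℤ → 𝔾 → ℚ
a /𝒩 q = a /ℕ ℤ.∣ 𝒩 q ∣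

frac : ℚ → ℚ
frac z = z ℚ.- (floor z ℚ./ 1)

f : ℚ → ℚ
f z = frac (z ℚ.+ ½) ℚ.- ½

module Submission where

-- Write q = a + b i, r = x + y i, N = 𝒩 q and d = (u - ũ) + (v - ṽ) i.  The two
-- differences of numerators in the statement are the coordinates of d·r·q̄ (the
-- second one up to sign), and since f z = z - ⌊z + ½⌋ each difference of f-values
-- has the form e / N with e ≡ (difference of numerators) mod N.  Collecting the
-- integer corrections into a Gaussian integer t, the sum of squares equals
--   (e₁² + e₂²) / N² = N · 𝒩 (d r - q t) / N² = 𝒩 (d r - q t) / N.
-- If q ∤ d then d r - q t ≠ 0, by Euclid's lemma in ℤ[i] (r is coprime to q), so
-- the sum is at least 1 / N.  If d = q c the numerators are congruent mod N, and
-- f, being 1-periodic, takes equal values, so the sum is 0.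

open import Defs
open import Data.Integer as ℤ using (ℤ; +_)
open import Data.Rational as ℚ using (ℚ; 0ℚ; 1ℚ; ½; floor; mkℚ; toℚᵘ)
open import Data.Rational.Unnormalised as ℚᵘ using (mkℚᵘ; *≡*; *≤*; *<*) renaming (_≃_ to _≃ᵘ_)
import Data.Rational.Properties as ℚP
import Data.Rational.Unnormalised.Properties as ℚᵘP
open import Data.Rational.Solver using (module +-*-Solver)
open import Relation.Binary.PropositionalEquality
open import Relation.Nullary using (¬_; Dec; yes; no)
open import Data.Product using (_×_; Σ; _,_; proj₁; proj₂)
open import Data.Sum using (inj₁; inj₂)
open import Data.Empty using (⊥-elim)
open import Data.List using (_∷_; [])
open import Data.Nat as ℕ using (ℕ; zero; suc; s≤s; z≤n)
import Data.Nat.Properties as ℕP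
import Data.Integer.Properties as ℤP
import Data.Integer.DivMod as ℤD
open import Data.Integer.Tactic.RingSolver using (solve-∀) renaming (solve to ℤ-solve)
import Data.Nat.Tactic.RingSolver as ℕSolver
open import Induction.WellFounded using (Acc; acc)
open import Data.Nat.Induction using (<-wellFounded)

-- ℤ[i] is a commutative ring.  The laws used below are checked coordinatewise by
-- the ring solver for ℤ (nested products need their coordinates spelled out).

infixl 6 _+𝔾_ _-𝔾_

_+𝔾_ : 𝔾 → 𝔾 → 𝔾
(a + b i) +𝔾 (c + d i) = (a ℤ.+ c) + (b ℤ.+ d) i

_-𝔾_ : 𝔾 → 𝔾 → 𝔾
(a + b i) -𝔾 (c + d i) = (a ℤ.- c) + (b ℤ.- d) i

𝔾-ext : ∀ {a b c d : ℤ} → a ≡ c → b ≡ d → (a + b i) ≡ (c + d i)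
𝔾-ext refl refl = refl

*𝔾-identityˡ : ∀ x → 1𝔾 *𝔾 x ≡ x
*𝔾-identityˡ (a + b i) = 𝔾-ext (ℤ-solve (a ∷ b ∷ [])) (ℤ-solve (a ∷ b ∷ []))

*𝔾-identityʳ : ∀ x → x *𝔾 1𝔾 ≡ x
*𝔾-identityʳ (a + b i) = 𝔾-ext (ℤ-solve (a ∷ b ∷ [])) (ℤ-solve (a ∷ b ∷ []))

*𝔾-zeroʳ : ∀ x → x *𝔾 0𝔾 ≡ 0𝔾
*𝔾-zeroʳ (a + b i) = 𝔾-ext (ℤ-solve (a ∷ b ∷ [])) (ℤ-solve (a ∷ b ∷ []))

*𝔾-comm : ∀ x y → x *𝔾 y ≡ y *𝔾 x
*𝔾-comm (a + b i) (c + d i) =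
  𝔾-ext (ℤ-solve (a ∷ b ∷ c ∷ d ∷ [])) (ℤ-solve (a ∷ b ∷ c ∷ d ∷ []))

*𝔾-assoc : ∀ x y z → (x *𝔾 y) *𝔾 z ≡ x *𝔾 (y *𝔾 z)
*𝔾-assoc (a + b i) (c + d i) (e + f′ i) = 𝔾-ext (re-assoc a b c d e f′) (im-assoc a b c d e f′)
  where
  re-assoc : ∀ a b c d e f′ → (a ℤ.* c ℤ.- b ℤ.* d) ℤ.* e ℤ.- (a ℤ.* d ℤ.+ b ℤ.* c) ℤ.* f′
                          ≡ a ℤ.* (c ℤ.* e ℤ.- d ℤ.* f′) ℤ.- b ℤ.* (c ℤ.* f′ ℤ.+ d ℤ.* e)
  re-assoc = solve-∀
  im-assoc : ∀ a b c d e f′ → (a ℤ.* c ℤ.- b ℤ.* d) ℤ.* f′ ℤ.+ (a ℤ.* d ℤ.+ b ℤ.* c) ℤ.* e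
                          ≡ a ℤ.* (c ℤ.* f′ ℤ.+ d ℤ.* e) ℤ.+ b ℤ.* (c ℤ.* e ℤ.- d ℤ.* f′)
  im-assoc = solve-∀

*𝔾-distribˡ-+ : ∀ x y z → x *𝔾 (y +𝔾 z) ≡ x *𝔾 y +𝔾 x *𝔾 z
*𝔾-distribˡ-+ (a + b i) (c + d i) (e + f′ i) = 𝔾-ext (re-distrib a b c d e f′) (im-distrib a b c d e f′)
  where
  re-distrib : ∀ a b c d e f′ → a ℤ.* (c ℤ.+ e) ℤ.- b ℤ.* (d ℤ.+ f′)
                            ≡ (a ℤ.* c ℤ.- b ℤ.* d) ℤ.+ (a ℤ.* e ℤ.- b ℤ.* f′)
  re-distrib = solve-∀
  im-distrib : ∀ a b c d e f′ → a ℤ.* (d ℤ.+ f′) ℤ.+ b ℤ.* (c ℤ.+ e)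
                            ≡ (a ℤ.* d ℤ.+ b ℤ.* c) ℤ.+ (a ℤ.* f′ ℤ.+ b ℤ.* e)
  im-distrib = solve-∀

*𝔾-distribˡ-- : ∀ x y z → x *𝔾 (y -𝔾 z) ≡ x *𝔾 y -𝔾 x *𝔾 z
*𝔾-distribˡ-- (a + b i) (c + d i) (e + f′ i) = 𝔾-ext (re-distrib a b c d e f′) (im-distrib a b c d e f′)
  where
  re-distrib : ∀ a b c d e f′ → a ℤ.* (c ℤ.- e) ℤ.- b ℤ.* (d ℤ.- f′)
                            ≡ (a ℤ.* c ℤ.- b ℤ.* d) ℤ.- (a ℤ.* e ℤ.- b ℤ.* f′)
  re-distrib = solve-∀
  im-distrib : ∀ a b c d e f′ → a ℤ.* (d ℤ.- f′) ℤ.+ b ℤ.* (c ℤ.- e)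
                            ≡ (a ℤ.* d ℤ.+ b ℤ.* c) ℤ.- (a ℤ.* f′ ℤ.+ b ℤ.* e)
  im-distrib = solve-∀

*𝔾-distribʳ-- : ∀ x y z → (x -𝔾 y) *𝔾 z ≡ x *𝔾 z -𝔾 y *𝔾 z
*𝔾-distribʳ-- x y z = begin
  (x -𝔾 y) *𝔾 z         ≡⟨ *𝔾-comm (x -𝔾 y) z ⟩
  z *𝔾 (x -𝔾 y)         ≡⟨ *𝔾-distribˡ-- z x y ⟩
  z *𝔾 x -𝔾 z *𝔾 y      ≡⟨ cong₂ _-𝔾_ (*𝔾-comm z x) (*𝔾-comm z y) ⟩
  x *𝔾 z -𝔾 y *𝔾 z      ∎
  where open ≡-Reasoning

*𝔾-swapʳ : ∀ x y z → (x *𝔾 y) *𝔾 z ≡ (x *𝔾 z) *𝔾 y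
*𝔾-swapʳ x y z = begin
  (x *𝔾 y) *𝔾 z  ≡⟨ *𝔾-assoc x y z ⟩
  x *𝔾 (y *𝔾 z)  ≡⟨ cong (x *𝔾_) (*𝔾-comm y z) ⟩
  x *𝔾 (z *𝔾 y)  ≡⟨ sym (*𝔾-assoc x z y) ⟩
  (x *𝔾 z) *𝔾 y  ∎
  where open ≡-Reasoning

x+[y-x]≡y : ∀ x y → x +𝔾 (y -𝔾 x) ≡ y
x+[y-x]≡y (a + b i) (c + d i) = 𝔾-ext (m+[n-m]≡n a c) (m+[n-m]≡n b d)
  where
  m+[n-m]≡n : ∀ m n → m ℤ.+ (n ℤ.- m) ≡ n
  m+[n-m]≡n = solve-∀

x-y≡0⇒y≡x : ∀ x y → x -𝔾 y ≡ 0𝔾 → y ≡ x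
x-y≡0⇒y≡x (a + b i) (c + d i) eq = 𝔾-ext (cancel a c (cong re eq)) (cancel b d (cong im eq))
  where
  cancel : ∀ a c → a ℤ.- c ≡ + 0 → c ≡ a
  cancel a c e = sym (ℤP.i-j≡0⇒i≡j a c e)

∣𝔾-refl : ∀ x → x ∣𝔾 x
∣𝔾-refl x = 1𝔾 , *𝔾-identityʳ x

∣𝔾-zero : ∀ x → x ∣𝔾 0𝔾
∣𝔾-zero x = 0𝔾 , *𝔾-zeroʳ x

∣𝔾-reduce⁻¹ : ∀ {g} a b c → g ∣𝔾 b → g ∣𝔾 (a -𝔾 b *𝔾 c) → g ∣𝔾 a
∣𝔾-reduce⁻¹ {g} a b c (cb , refl) (cρ , gcρ≡ρ) = cb *𝔾 c +𝔾 cρ , (begin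
    g *𝔾 (cb *𝔾 c +𝔾 cρ)          ≡⟨ *𝔾-distribˡ-+ g (cb *𝔾 c) cρ ⟩
    g *𝔾 (cb *𝔾 c) +𝔾 g *𝔾 cρ     ≡⟨ cong₂ _+𝔾_ (sym (*𝔾-assoc g cb c)) gcρ≡ρ ⟩
    (g *𝔾 cb) *𝔾 c +𝔾 (a -𝔾 (g *𝔾 cb) *𝔾 c) ≡⟨ x+[y-x]≡y ((g *𝔾 cb) *𝔾 c) a ⟩
    a                               ∎)
  where open ≡-Reasoning

_² : ℤ → ℤ
e ² = e ℤ.* e

square≡∣∣² : ∀ a → a ² ≡ + (ℤ.∣ a ∣ ℕ.* ℤ.∣ a ∣)
square≡∣∣² (+ zero)   = refl
square≡∣∣² ℤ.+[1+ n ] = refl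
square≡∣∣² ℤ.-[1+ n ] = refl

-- norm is kept opaque: only norm≡𝒩 and norm≡0⇒≡0 are used, and unfolding it
-- on large arguments is expensive.
opaque
  norm : 𝔾 → ℕ
  norm (a + b i) = ℤ.∣ a ∣ ℕ.* ℤ.∣ a ∣ ℕ.+ ℤ.∣ b ∣ ℕ.* ℤ.∣ b ∣

  norm≡𝒩 : ∀ z → + norm z ≡ 𝒩 z
  norm≡𝒩 (a + b i) = begin
    + (ℤ.∣ a ∣ ℕ.* ℤ.∣ a ∣ ℕ.+ ℤ.∣ b ∣ ℕ.* ℤ.∣ b ∣)       ≡⟨ ℤP.pos-+ (ℤ.∣ a ∣ ℕ.* ℤ.∣ a ∣) _ ⟩
    + (ℤ.∣ a ∣ ℕ.* ℤ.∣ a ∣) ℤ.+ + (ℤ.∣ b ∣ ℕ.* ℤ.∣ b ∣) ≡⟨ sym (cong₂ ℤ._+_ (square≡∣∣² a) (square≡∣∣² b)) ⟩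
    a ℤ.* a ℤ.+ b ℤ.* b                                 ∎
    where open ≡-Reasoning

  ∣𝒩∣≡norm : ∀ z → ℤ.∣ 𝒩 z ∣ ≡ norm z
  ∣𝒩∣≡norm z = cong ℤ.∣_∣ (sym (norm≡𝒩 z))

  norm≡0⇒≡0 : ∀ z → norm z ≡ 0 → z ≡ 0𝔾
  norm≡0⇒≡0 (a + b i) eq =
    𝔾-ext (square≡0 a (ℕP.m+n≡0⇒m≡0 _ eq)) (square≡0 b (ℕP.m+n≡0⇒n≡0 _ eq))
    where
    square≡0 : ∀ a → ℤ.∣ a ∣ ℕ.* ℤ.∣ a ∣ ≡ 0 → a ≡ + 0
    square≡0 a e with ℕP.m*n≡0⇒m≡0∨n≡0 ℤ.∣ a ∣ e
    ... | inj₁ ∣a∣≡0 = ℤP.∣i∣≡0⇒i≡0 ∣a∣≡0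
    ... | inj₂ ∣a∣≡0 = ℤP.∣i∣≡0⇒i≡0 ∣a∣≡0

-- Euclidean division in ℤ[i] is obtained by rounding to nearest integers.

HalfBounded : ℕ → ℤ → Set
HalfBounded n e = ℤ.∣ e ∣ ℕ.+ ℤ.∣ e ∣ ℕ.≤ n

nearest-quotient : ∀ P n → Σ ℤ λ c → HalfBounded (suc n) (P ℤ.- c ℤ.* + suc n)
nearest-quotient P n = choose (r ℕ.+ r ℕ.≤? suc n)
  where
  N = + suc n
  r = P ℤD.% N
  s = P ℤD./ N
  P≡r+sN : P ≡ + r ℤ.+ s ℤ.* N
  P≡r+sN = ℤD.a≡a%n+[a/n]*n P N
  r≤n : r ℕ.≤ suc n
  r≤n = ℕP.<⇒≤ (ℤD.n%d<d P N)
  choose : Dec (r ℕ.+ r ℕ.≤ suc n) → Σ ℤ λ c → HalfBounded (suc n) (P ℤ.- c ℤ.* N)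
  choose (yes 2r≤n) = s , subst (HalfBounded (suc n)) (sym round-down) 2r≤n
    where
    identity : ∀ R S N → (R ℤ.+ S ℤ.* N) ℤ.- S ℤ.* N ≡ R
    identity = solve-∀
    round-down : P ℤ.- s ℤ.* N ≡ + r
    round-down = trans (cong (ℤ._- s ℤ.* N) P≡r+sN) (identity (+ r) s N)
  choose (no 2r≰n) = s ℤ.+ + 1 , subst (HalfBounded (suc n)) (sym round-up) 2h≤n
    where
    h = suc n ℕ.∸ r
    r+h≡n : r ℕ.+ h ≡ suc n
    r+h≡n = ℕP.m+[n∸m]≡n r≤n
    identity : ∀ R S N → (R ℤ.+ S ℤ.* N) ℤ.- (S ℤ.+ + 1) ℤ.* N ≡ ℤ.- (N ℤ.- R)
    identity = solve-∀
    round-up : P ℤ.- (s ℤ.+ + 1) ℤ.* N ≡ ℤ.- (+ h)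
    round-up = begin
      P ℤ.- (s ℤ.+ + 1) ℤ.* N ≡⟨ cong (ℤ._- (s ℤ.+ + 1) ℤ.* N) P≡r+sN ⟩
      (+ r ℤ.+ s ℤ.* N) ℤ.- (s ℤ.+ + 1) ℤ.* N ≡⟨ identity (+ r) s N ⟩
      ℤ.- (N ℤ.- + r) ≡⟨ cong ℤ.-_ (trans (ℤP.m-n≡m⊖n (suc n) r) (ℤP.⊖-≥ r≤n)) ⟩
      ℤ.- (+ h) ∎
      where open ≡-Reasoning
    h<r : h ℕ.< r
    h<r = ℕP.+-cancelˡ-< r h r (subst (ℕ._< r ℕ.+ r) (sym r+h≡n) (ℕP.≰⇒> 2r≰n))
    2h≤n : HalfBounded (suc n) (ℤ.- (+ h))
    2h≤n = subst (λ k → k ℕ.+ k ℕ.≤ suc n) (sym (ℤP.∣-i∣≡∣i∣ (+ h)))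
             (ℕP.<⇒≤ (subst (h ℕ.+ h ℕ.<_) r+h≡n (ℕP.+-monoˡ-< h h<r)))

sum-of-half-squares : ∀ n k h₁ h₂ → suc n ℕ.* k ≡ h₁ ℕ.* h₁ ℕ.+ h₂ ℕ.* h₂ →
                      h₁ ℕ.+ h₁ ℕ.≤ suc n → h₂ ℕ.+ h₂ ℕ.≤ suc n → k ℕ.< suc n
sum-of-half-squares n k h₁ h₂ n·k≡ 2h₁≤n 2h₂≤n with k ℕ.<? suc n
... | yes k<n = k<n
... | no k≮n = ⊥-elim (4≰2 (ℕP.*-cancelʳ-≤ 4 2 (suc n ℕ.* suc n) 4n²≤2n²))
  where
  expand : ∀ a b → (a ℕ.+ a) ℕ.* (a ℕ.+ a) ℕ.+ (b ℕ.+ b) ℕ.* (b ℕ.+ b) ≡ 4 ℕ.* (a ℕ.* a ℕ.+ b ℕ.* b)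
  expand = ℕSolver.solve-∀
  double : ∀ x → x ℕ.+ x ≡ 2 ℕ.* x
  double = ℕSolver.solve-∀
  4n²≤2n² : 4 ℕ.* (suc n ℕ.* suc n) ℕ.≤ 2 ℕ.* (suc n ℕ.* suc n)
  4n²≤2n² = begin
    4 ℕ.* (suc n ℕ.* suc n)   ≤⟨ ℕP.*-monoʳ-≤ 4 (ℕP.*-monoʳ-≤ (suc n) (ℕP.≮⇒≥ k≮n)) ⟩
    4 ℕ.* (suc n ℕ.* k)       ≡⟨ cong (4 ℕ.*_) n·k≡ ⟩
    4 ℕ.* (h₁ ℕ.* h₁ ℕ.+ h₂ ℕ.* h₂) ≡⟨ sym (expand h₁ h₂) ⟩
    (h₁ ℕ.+ h₁) ℕ.* (h₁ ℕ.+ h₁) ℕ.+ (h₂ ℕ.+ h₂) ℕ.* (h₂ ℕ.+ h₂)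
      ≤⟨ ℕP.+-mono-≤ (ℕP.*-mono-≤ 2h₁≤n 2h₁≤n) (ℕP.*-mono-≤ 2h₂≤n 2h₂≤n) ⟩
    suc n ℕ.* suc n ℕ.+ suc n ℕ.* suc n ≡⟨ double (suc n ℕ.* suc n) ⟩
    2 ℕ.* (suc n ℕ.* suc n)   ∎
    where open ℕP.≤-Reasoning
  4≰2 : ¬ (4 ℕ.≤ 2)
  4≰2 (s≤s (s≤s ()))

-- Dividing a by b amounts to dividing b̄ a = P + Q i by N = 𝒩 b: for every c,
-- N · 𝒩 (a - b c) = (P - N c₁)² + (Q - N c₂)².
remainder-norm : ∀ a₁ a₂ b₁ b₂ c₁ c₂ {N} → 𝒩 (b₁ + b₂ i) ≡ N →
  N ℤ.* 𝒩 ((a₁ + a₂ i) -𝔾 (b₁ + b₂ i) *𝔾 (c₁ + c₂ i))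
    ≡ ((a₁ ℤ.* b₁ ℤ.+ a₂ ℤ.* b₂) ℤ.- c₁ ℤ.* N) ² ℤ.+ ((a₂ ℤ.* b₁ ℤ.- a₁ ℤ.* b₂) ℤ.- c₂ ℤ.* N) ²
remainder-norm a₁ a₂ b₁ b₂ c₁ c₂ refl = identity a₁ a₂ b₁ b₂ c₁ c₂
  where
  identity : ∀ a₁ a₂ b₁ b₂ c₁ c₂ →
    (b₁ ℤ.* b₁ ℤ.+ b₂ ℤ.* b₂) ℤ.*
      ((a₁ ℤ.- (b₁ ℤ.* c₁ ℤ.- b₂ ℤ.* c₂)) ℤ.* (a₁ ℤ.- (b₁ ℤ.* c₁ ℤ.- b₂ ℤ.* c₂))
       ℤ.+ (a₂ ℤ.- (b₁ ℤ.* c₂ ℤ.+ b₂ ℤ.* c₁)) ℤ.* (a₂ ℤ.- (b₁ ℤ.* c₂ ℤ.+ b₂ ℤ.* c₁)))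
    ≡ ((a₁ ℤ.* b₁ ℤ.+ a₂ ℤ.* b₂) ℤ.- c₁ ℤ.* (b₁ ℤ.* b₁ ℤ.+ b₂ ℤ.* b₂))
        ℤ.* ((a₁ ℤ.* b₁ ℤ.+ a₂ ℤ.* b₂) ℤ.- c₁ ℤ.* (b₁ ℤ.* b₁ ℤ.+ b₂ ℤ.* b₂))
      ℤ.+ ((a₂ ℤ.* b₁ ℤ.- a₁ ℤ.* b₂) ℤ.- c₂ ℤ.* (b₁ ℤ.* b₁ ℤ.+ b₂ ℤ.* b₂))
        ℤ.* ((a₂ ℤ.* b₁ ℤ.- a₁ ℤ.* b₂) ℤ.- c₂ ℤ.* (b₁ ℤ.* b₁ ℤ.+ b₂ ℤ.* b₂))
  identity = solve-∀

-- Division with remainder: when b ≠ 0, rounding both coordinates of b̄ a / N gives a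
-- quotient c with 𝒩 (a - b c) ≤ 𝒩 b / 2 < 𝒩 b.
divide : ∀ a b {n} → norm b ≡ suc n → Σ 𝔾 λ c → norm (a -𝔾 b *𝔾 c) ℕ.< suc n
divide (a₁ + a₂ i) b@(b₁ + b₂ i) {n} norm-b
  with nearest-quotient (a₁ ℤ.* b₁ ℤ.+ a₂ ℤ.* b₂) n | nearest-quotient (a₂ ℤ.* b₁ ℤ.- a₁ ℤ.* b₂) n
... | c₁ , bound₁ | c₂ , bound₂ =
  c₁ + c₂ i , sum-of-half-squares n (norm ρ) ℤ.∣ e₁ ∣ ℤ.∣ e₂ ∣ n·normρ≡ bound₁ bound₂
  where
  N = + suc n
  ρ = (a₁ + a₂ i) -𝔾 b *𝔾 (c₁ + c₂ i)
  e₁ = (a₁ ℤ.* b₁ ℤ.+ a₂ ℤ.* b₂) ℤ.- c₁ ℤ.* N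
  e₂ = (a₂ ℤ.* b₁ ℤ.- a₁ ℤ.* b₂) ℤ.- c₂ ℤ.* N
  n·normρ≡ : suc n ℕ.* norm ρ ≡ ℤ.∣ e₁ ∣ ℕ.* ℤ.∣ e₁ ∣ ℕ.+ ℤ.∣ e₂ ∣ ℕ.* ℤ.∣ e₂ ∣
  n·normρ≡ = ℤP.+-injective (begin
    + (suc n ℕ.* norm ρ)        ≡⟨ ℤP.pos-* (suc n) (norm ρ) ⟩
    N ℤ.* + norm ρ              ≡⟨ cong (N ℤ.*_) (norm≡𝒩 ρ) ⟩
    N ℤ.* 𝒩 ρ                   ≡⟨ remainder-norm a₁ a₂ b₁ b₂ c₁ c₂ (trans (sym (norm≡𝒩 b)) (cong +_ norm-b)) ⟩
    e₁ ² ℤ.+ e₂ ²               ≡⟨ cong₂ ℤ._+_ (square≡∣∣² e₁) (square≡∣∣² e₂) ⟩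
    + (ℤ.∣ e₁ ∣ ℕ.* ℤ.∣ e₁ ∣) ℤ.+ + (ℤ.∣ e₂ ∣ ℕ.* ℤ.∣ e₂ ∣)
                                ≡⟨ sym (ℤP.pos-+ (ℤ.∣ e₁ ∣ ℕ.* ℤ.∣ e₁ ∣) _) ⟩
    + (ℤ.∣ e₁ ∣ ℕ.* ℤ.∣ e₁ ∣ ℕ.+ ℤ.∣ e₂ ∣ ℕ.* ℤ.∣ e₂ ∣) ∎)
    where open ≡-Reasoning

CommonDivisorIn : (𝔾 → Set) → 𝔾 → 𝔾 → Set
CommonDivisorIn I a b = Σ 𝔾 λ g → I g × g ∣𝔾 a × g ∣𝔾 b

-- Any set I of Gaussian integers closed under the Euclidean reduction (a, b) ↦ a - b c
-- contains a common divisor of any two of its elements (their gcd): this is the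
-- Euclidean algorithm, by well-founded recursion on the norm of the second element.
common-divisor-in : (I : 𝔾 → Set) → (∀ a b c → I a → I b → I (a -𝔾 b *𝔾 c)) →
                    ∀ a b → I a → I b → CommonDivisorIn I a b
common-divisor-in I I-reduce a b = go a b (<-wellFounded (norm b))
  where
  lift : ∀ a b c → CommonDivisorIn I b (a -𝔾 b *𝔾 c) → CommonDivisorIn I a b
  lift a b c (g , Ig , g∣b , g∣ρ) = g , Ig , ∣𝔾-reduce⁻¹ {g} a b c g∣b g∣ρ , g∣b
  go : ∀ a b → Acc ℕ._<_ (norm b) → I a → I b → CommonDivisorIn I a b
  go a b (acc smaller) Ia Ib with norm b in norm-b
  ... | zero  = a , Ia , ∣𝔾-refl a , subst (a ∣𝔾_) (sym (norm≡0⇒≡0 b norm-b)) (∣𝔾-zero a)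
  ... | suc n = let (c , ρ<b) = divide a b norm-b in
                lift a b c (go b (a -𝔾 b *𝔾 c) (smaller ρ<b) Ib (I-reduce a b c Ia Ib))

multiplier-reduce : ∀ q d a b c → q ∣𝔾 (a *𝔾 d) → q ∣𝔾 (b *𝔾 d) → q ∣𝔾 ((a -𝔾 b *𝔾 c) *𝔾 d)
multiplier-reduce q d a b c (ca , qca≡ad) (cb , qcb≡bd) = ca -𝔾 cb *𝔾 c , (begin
  q *𝔾 (ca -𝔾 cb *𝔾 c)           ≡⟨ *𝔾-distribˡ-- q ca (cb *𝔾 c) ⟩
  q *𝔾 ca -𝔾 q *𝔾 (cb *𝔾 c)      ≡⟨ cong₂ _-𝔾_ qca≡ad (trans (sym (*𝔾-assoc q cb c)) (cong (_*𝔾 c) qcb≡bd)) ⟩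
  a *𝔾 d -𝔾 (b *𝔾 d) *𝔾 c        ≡⟨ cong (a *𝔾 d -𝔾_) (*𝔾-swapʳ b d c) ⟩
  a *𝔾 d -𝔾 (b *𝔾 c) *𝔾 d        ≡⟨ sym (*𝔾-distribʳ-- a (b *𝔾 c) d) ⟩
  (a -𝔾 b *𝔾 c) *𝔾 d             ∎)
  where open ≡-Reasoning

-- Euclid's lemma: if r is coprime to q and q ∣ d r, then q ∣ d.  The x with
-- q ∣ x d contain q and r, hence a common divisor g of q and r; g is a unit.
euclid : ∀ q r d → Coprime𝔾 r q → q ∣𝔾 (d *𝔾 r) → q ∣𝔾 d
euclid q r d r⊥q (c , qc≡dr) = conclude (common-divisor-in (λ x → q ∣𝔾 (x *𝔾 d))
  (multiplier-reduce q d) q r (d , refl) (c , trans qc≡dr (*𝔾-comm d r)))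
  where
  conclude : CommonDivisorIn (λ x → q ∣𝔾 (x *𝔾 d)) q r → q ∣𝔾 d
  conclude (g , (c′ , qc′≡gd) , g∣q , g∣r) = let (h , gh≡1) = r⊥q g g∣r g∣q in
    c′ *𝔾 h , (begin
      q *𝔾 (c′ *𝔾 h)   ≡⟨ sym (*𝔾-assoc q c′ h) ⟩
      (q *𝔾 c′) *𝔾 h   ≡⟨ cong (_*𝔾 h) qc′≡gd ⟩
      (g *𝔾 d) *𝔾 h    ≡⟨ *𝔾-swapʳ g d h ⟩
      (g *𝔾 h) *𝔾 d    ≡⟨ cong (_*𝔾 d) gh≡1 ⟩
      1𝔾 *𝔾 d          ≡⟨ *𝔾-identityˡ d ⟩
      d                ∎)
    where open ≡-Reasoning

-- The embedding ι : ℤ → ℚ is a monotone ring homomorphism; all its properties are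
-- transported from the unnormalised rationals, where ι a is simply a / 1.

ι : ℤ → ℚ
ι a = a ℚ./ 1

toℚᵘ-ι : ∀ a → toℚᵘ (ι a) ≃ᵘ mkℚᵘ a 0
toℚᵘ-ι a = ℚP.toℚᵘ-fromℚᵘ (mkℚᵘ a 0)

ι-+ : ∀ a b → ι (a ℤ.+ b) ≡ ι a ℚ.+ ι b
ι-+ a b = ℚP.toℚᵘ-injective (begin
  toℚᵘ (ι (a ℤ.+ b))          ≈⟨ toℚᵘ-ι (a ℤ.+ b) ⟩
  mkℚᵘ (a ℤ.+ b) 0            ≈⟨ *≡* (identity a b) ⟩
  mkℚᵘ a 0 ℚᵘ.+ mkℚᵘ b 0      ≈⟨ ℚᵘP.≃-sym (ℚᵘP.+-cong (toℚᵘ-ι a) (toℚᵘ-ι b)) ⟩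
  toℚᵘ (ι a) ℚᵘ.+ toℚᵘ (ι b)  ≈⟨ ℚᵘP.≃-sym (ℚP.toℚᵘ-homo-+ (ι a) (ι b)) ⟩
  toℚᵘ (ι a ℚ.+ ι b)          ∎)
  where
  open ℚᵘP.≃-Reasoning
  identity : ∀ a b → (a ℤ.+ b) ℤ.* + 1 ≡ (a ℤ.* + 1 ℤ.+ b ℤ.* + 1) ℤ.* + 1
  identity = solve-∀

ι-* : ∀ a b → ι (a ℤ.* b) ≡ ι a ℚ.* ι b
ι-* a b = ℚP.toℚᵘ-injective (begin
  toℚᵘ (ι (a ℤ.* b))          ≈⟨ toℚᵘ-ι (a ℤ.* b) ⟩
  mkℚᵘ a 0 ℚᵘ.* mkℚᵘ b 0      ≈⟨ ℚᵘP.≃-sym (ℚᵘP.*-cong (toℚᵘ-ι a) (toℚᵘ-ι b)) ⟩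
  toℚᵘ (ι a) ℚᵘ.* toℚᵘ (ι b)  ≈⟨ ℚᵘP.≃-sym (ℚP.toℚᵘ-homo-* (ι a) (ι b)) ⟩
  toℚᵘ (ι a ℚ.* ι b)          ∎)
  where open ℚᵘP.≃-Reasoning

ι-neg : ∀ a → ι (ℤ.- a) ≡ ℚ.- ι a
ι-neg a = ℚP.toℚᵘ-injective (begin
  toℚᵘ (ι (ℤ.- a))    ≈⟨ toℚᵘ-ι (ℤ.- a) ⟩
  ℚᵘ.- mkℚᵘ a 0       ≈⟨ ℚᵘP.≃-sym (ℚᵘP.-‿cong (toℚᵘ-ι a)) ⟩
  ℚᵘ.- toℚᵘ (ι a)     ≈⟨ ℚᵘP.≃-sym (ℚP.toℚᵘ-homo‿- (ι a)) ⟩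
  toℚᵘ (ℚ.- ι a)      ∎)
  where open ℚᵘP.≃-Reasoning

ι-- : ∀ a b → ι (a ℤ.- b) ≡ ι a ℚ.- ι b
ι-- a b = trans (ι-+ a (ℤ.- b)) (cong (ι a ℚ.+_) (ι-neg b))

ι-mono-≤ : ∀ {a b} → a ℤ.≤ b → ι a ℚ.≤ ι b
ι-mono-≤ {a} {b} a≤b = ℚP.toℚᵘ-cancel-≤
  (ℚᵘP.≤-respˡ-≃ (ℚᵘP.≃-sym (toℚᵘ-ι a)) (ℚᵘP.≤-respʳ-≃ (ℚᵘP.≃-sym (toℚᵘ-ι b))
    (*≤* (subst₂ ℤ._≤_ (sym (ℤP.*-identityʳ a)) (sym (ℤP.*-identityʳ b)) a≤b))))

-- ⌊p⌋ is the unique integer t with t ≤ p < t + 1; hence ⌊p + K⌋ = ⌊p⌋ + K for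
-- integers K, and f is 1-periodic.

floor-≤ : ∀ p → ι (floor p) ℚ.≤ p
floor-≤ p@(mkℚ num d-1 _) = ℚP.toℚᵘ-cancel-≤ (ℚᵘP.≤-respˡ-≃ (ℚᵘP.≃-sym (toℚᵘ-ι (floor p)))
  (*≤* (subst (floor p ℤ.* + suc d-1 ℤ.≤_) (sym (ℤP.*-identityʳ num)) (ℤD.[n/d]*d≤n num (+ suc d-1)))))

<-suc-quotient : ∀ n d → n ℤ.< ℤ.suc (n ℤD./ + suc d) ℤ.* + suc d
<-suc-quotient n d =
  subst (λ t → n ℤ.< ℤ.suc t ℤ.* + suc d) (sym (ℤD.div-pos-is-/ℕ n (suc d))) (ℤD.n<s[n/ℕd]*d n (suc d))

<-floor+1 : ∀ p → p ℚ.< ι (ℤ.suc (floor p))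
<-floor+1 p@(mkℚ num d-1 _) = ℚP.toℚᵘ-cancel-< (ℚᵘP.<-respʳ-≃ (ℚᵘP.≃-sym (toℚᵘ-ι (ℤ.suc (floor p))))
  (*<* (subst (ℤ._< ℤ.suc (floor p) ℤ.* + suc d-1) (sym (ℤP.*-identityʳ num)) (<-suc-quotient num d-1))))

<-suc⇒≤ : ∀ {s t} → s ℤ.< ℤ.suc t → s ℤ.≤ t
<-suc⇒≤ {s} {t} s<t+1 = subst (s ℤ.≤_) (ℤP.pred-suc t) (ℤP.i<j⇒i≤pred[j] s<t+1)

floor-unique : ∀ p t → ι t ℚ.≤ p → p ℚ.< ι (ℤ.suc t) → floor p ≡ t
floor-unique p@(mkℚ num d-1 _) t t≤p p<t+1 = ℤP.≤-antisym ⌊p⌋≤t t≤⌊p⌋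
  where
  D = + suc d-1
  tD≤num : t ℤ.* D ℤ.≤ num
  tD≤num with ℚᵘP.≤-respˡ-≃ (toℚᵘ-ι t) (ℚP.toℚᵘ-mono-≤ t≤p)
  ... | *≤* le = subst (t ℤ.* D ℤ.≤_) (ℤP.*-identityʳ num) le
  num<[t+1]D : num ℤ.< ℤ.suc t ℤ.* D
  num<[t+1]D with ℚᵘP.<-respʳ-≃ (toℚᵘ-ι (ℤ.suc t)) (ℚP.toℚᵘ-mono-< p<t+1)
  ... | *<* lt = subst (ℤ._< ℤ.suc t ℤ.* D) (ℤP.*-identityʳ num) lt
  t≤⌊p⌋ : t ℤ.≤ floor p
  t≤⌊p⌋ = <-suc⇒≤ (ℤP.*-cancelʳ-<-nonNeg D (ℤP.≤-<-trans tD≤num (<-suc-quotient num d-1)))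
  ⌊p⌋≤t : floor p ℤ.≤ t
  ⌊p⌋≤t = <-suc⇒≤ (ℤP.*-cancelʳ-<-nonNeg D (ℤP.≤-<-trans (ℤD.[n/d]*d≤n num D) num<[t+1]D))

floor-+ι : ∀ p K → floor (p ℚ.+ ι K) ≡ floor p ℤ.+ K
floor-+ι p K = floor-unique (p ℚ.+ ι K) (floor p ℤ.+ K) lower upper
  where
  lower : ι (floor p ℤ.+ K) ℚ.≤ p ℚ.+ ι K
  lower = subst (ℚ._≤ p ℚ.+ ι K) (sym (ι-+ (floor p) K)) (ℚP.+-monoˡ-≤ (ι K) (floor-≤ p))
  upper : p ℚ.+ ι K ℚ.< ι (ℤ.suc (floor p ℤ.+ K))
  upper = subst (p ℚ.+ ι K ℚ.<_)
            (trans (sym (ι-+ (ℤ.suc (floor p)) K)) (cong ι (ℤP.+-assoc (+ 1) (floor p) K)))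
            (ℚP.+-monoˡ-< (ι K) (<-floor+1 p))

f-spec : ∀ z → f z ≡ z ℚ.- ι (floor (z ℚ.+ ½))
f-spec z = solve 3 (λ z h T → ((z :+ h) :- T) :- h := z :- T) refl z ½ (ι (floor (z ℚ.+ ½)))
  where open +-*-Solver

f-periodic : ∀ z K → f (z ℚ.+ ι K) ≡ f z
f-periodic z K = begin
  f (z ℚ.+ ι K)                                   ≡⟨ f-spec (z ℚ.+ ι K) ⟩
  (z ℚ.+ ι K) ℚ.- ι (floor ((z ℚ.+ ι K) ℚ.+ ½))   ≡⟨ cong (λ t → (z ℚ.+ ι K) ℚ.- ι (floor t)) (swap z (ι K) ½) ⟩
  (z ℚ.+ ι K) ℚ.- ι (floor ((z ℚ.+ ½) ℚ.+ ι K))   ≡⟨ cong (λ t → (z ℚ.+ ι K) ℚ.- ι t) (floor-+ι (z ℚ.+ ½) K) ⟩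
  (z ℚ.+ ι K) ℚ.- ι (T ℤ.+ K)                     ≡⟨ cong (λ t → (z ℚ.+ ι K) ℚ.- t) (ι-+ T K) ⟩
  (z ℚ.+ ι K) ℚ.- (ι T ℚ.+ ι K)                   ≡⟨ cancel z (ι K) (ι T) ⟩
  z ℚ.- ι T                                       ≡⟨ sym (f-spec z) ⟩
  f z                                             ∎
  where
  open ≡-Reasoning
  open +-*-Solver
  T = floor (z ℚ.+ ½)
  swap : ∀ z k h → (z ℚ.+ k) ℚ.+ h ≡ (z ℚ.+ h) ℚ.+ k
  swap = solve 3 (λ z k h → (z :+ k) :+ h := (z :+ h) :+ k) refl
  cancel : ∀ z k t → (z ℚ.+ k) ℚ.- (t ℚ.+ k) ≡ z ℚ.- t
  cancel = solve 3 (λ z k t → (z :+ k) :- (t :+ k) := z :- t) refl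

squared-length : ℚ → ℚ → ℚ
squared-length X Y = ℚ.∣ X ∣ ℚ.* ℚ.∣ X ∣ ℚ.+ ℚ.∣ Y ∣ ℚ.* ℚ.∣ Y ∣

module Denominator (m : ℕ) where
  open +-*-Solver

  N : ℤ
  N = + suc m

  w : ℚ
  w = + 1 ℚ./ suc m

  /≡ι*w : ∀ A → A ℚ./ suc m ≡ ι A ℚ.* w
  /≡ι*w A = ℚP.toℚᵘ-injective (begin
    toℚᵘ (A ℚ./ suc m)          ≈⟨ ℚP.toℚᵘ-fromℚᵘ (mkℚᵘ A m) ⟩
    mkℚᵘ A m                    ≈⟨ *≡* (trans (cong (λ j → A ℤ.* + suc j) (ℕP.+-identityʳ m)) (identity A N)) ⟩
    mkℚᵘ A 0 ℚᵘ.* mkℚᵘ (+ 1) m  ≈⟨ ℚᵘP.≃-sym (ℚᵘP.*-cong (toℚᵘ-ι A) (ℚP.toℚᵘ-fromℚᵘ (mkℚᵘ (+ 1) m))) ⟩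
    toℚᵘ (ι A) ℚᵘ.* toℚᵘ w      ≈⟨ ℚᵘP.≃-sym (ℚP.toℚᵘ-homo-* (ι A) w) ⟩
    toℚᵘ (ι A ℚ.* w)            ∎)
    where
    open ℚᵘP.≃-Reasoning
    identity : ∀ A N → A ℤ.* N ≡ (A ℤ.* + 1) ℤ.* N
    identity = solve-∀

  ιN*w≡1 : ι N ℚ.* w ≡ 1ℚ
  ιN*w≡1 = ℚP.toℚᵘ-injective (begin
    toℚᵘ (ι N ℚ.* w)              ≈⟨ ℚP.toℚᵘ-homo-* (ι N) w ⟩
    toℚᵘ (ι N) ℚᵘ.* toℚᵘ w        ≈⟨ ℚᵘP.*-cong (toℚᵘ-ι N) (ℚP.toℚᵘ-fromℚᵘ (mkℚᵘ (+ 1) m)) ⟩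
    mkℚᵘ N 0 ℚᵘ.* mkℚᵘ (+ 1) m    ≈⟨ *≡* (trans (identity N) (cong (λ j → + 1 ℤ.* + suc j) (sym (ℕP.+-identityʳ m)))) ⟩
    toℚᵘ 1ℚ                       ∎)
    where
    open ℚᵘP.≃-Reasoning
    identity : ∀ N → (N ℤ.* + 1) ℤ.* + 1 ≡ + 1 ℤ.* N
    identity = solve-∀

  f-difference : ∀ A B E → A ℤ.- B ≡ E → Σ ℤ λ t → f (A ℚ./ suc m) ℚ.- f (B ℚ./ suc m) ≡ ι (E ℤ.- N ℤ.* t) ℚ.* w
  f-difference A B E A-B≡E = T₁ ℤ.- T₂ , (begin
    f (A ℚ./ suc m) ℚ.- f (B ℚ./ suc m)
      ≡⟨ cong₂ ℚ._-_ (f-spec (A ℚ./ suc m)) (f-spec (B ℚ./ suc m)) ⟩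
    (A ℚ./ suc m ℚ.- ι T₁) ℚ.- (B ℚ./ suc m ℚ.- ι T₂)
      ≡⟨ cong₂ (λ X Y → (X ℚ.- ι T₁) ℚ.- (Y ℚ.- ι T₂)) (/≡ι*w A) (/≡ι*w B) ⟩
    (ι A ℚ.* w ℚ.- ι T₁) ℚ.- (ι B ℚ.* w ℚ.- ι T₂)
      ≡⟨ regroup (ι A) (ι B) (ι T₁) (ι T₂) w ⟩
    (ι A ℚ.- ι B) ℚ.* w ℚ.- (ι T₁ ℚ.- ι T₂) ℚ.* 1ℚ
      ≡⟨ cong (λ one → (ι A ℚ.- ι B) ℚ.* w ℚ.- (ι T₁ ℚ.- ι T₂) ℚ.* one) (sym ιN*w≡1) ⟩
    (ι A ℚ.- ι B) ℚ.* w ℚ.- (ι T₁ ℚ.- ι T₂) ℚ.* (ι N ℚ.* w)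
      ≡⟨ factor (ι A ℚ.- ι B) (ι N) (ι T₁ ℚ.- ι T₂) w ⟩
    ((ι A ℚ.- ι B) ℚ.- ι N ℚ.* (ι T₁ ℚ.- ι T₂)) ℚ.* w
      ≡⟨ cong (ℚ._* w) (sym ι-numerator) ⟩
    ι ((A ℤ.- B) ℤ.- N ℤ.* (T₁ ℤ.- T₂)) ℚ.* w
      ≡⟨ cong (λ Z → ι (Z ℤ.- N ℤ.* (T₁ ℤ.- T₂)) ℚ.* w) A-B≡E ⟩
    ι (E ℤ.- N ℤ.* (T₁ ℤ.- T₂)) ℚ.* w ∎)
    where
    open ≡-Reasoning
    T₁ = floor (A ℚ./ suc m ℚ.+ ½)
    T₂ = floor (B ℚ./ suc m ℚ.+ ½)
    regroup : ∀ a b t₁ t₂ w → (a ℚ.* w ℚ.- t₁) ℚ.- (b ℚ.* w ℚ.- t₂) ≡ (a ℚ.- b) ℚ.* w ℚ.- (t₁ ℚ.- t₂) ℚ.* 1ℚ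
    regroup = solve 5 (λ a b t₁ t₂ w → (a :* w :- t₁) :- (b :* w :- t₂) := (a :- b) :* w :- (t₁ :- t₂) :* con 1ℚ) refl
    factor : ∀ e n t w → e ℚ.* w ℚ.- t ℚ.* (n ℚ.* w) ≡ (e ℚ.- n ℚ.* t) ℚ.* w
    factor = solve 4 (λ e n t w → e :* w :- t :* (n :* w) := (e :- n :* t) :* w) refl
    ι-numerator : ι ((A ℤ.- B) ℤ.- N ℤ.* (T₁ ℤ.- T₂)) ≡ (ι A ℚ.- ι B) ℚ.- ι N ℚ.* (ι T₁ ℚ.- ι T₂)
    ι-numerator = trans (ι-- (A ℤ.- B) (N ℤ.* (T₁ ℤ.- T₂)))
                    (cong₂ ℚ._-_ (ι-- A B) (trans (ι-* N (T₁ ℤ.- T₂)) (cong (ι N ℚ.*_) (ι-- T₁ T₂))))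

  f-congruent : ∀ A B K → A ℤ.- B ≡ N ℤ.* K → f (A ℚ./ suc m) ≡ f (B ℚ./ suc m)
  f-congruent A B K A-B≡NK = trans (cong f A/N≡B/N+K) (f-periodic (B ℚ./ suc m) K)
    where
    open ≡-Reasoning
    split : ∀ A B → A ≡ B ℤ.+ (A ℤ.- B)
    split = solve-∀
    shift : ∀ b n k w → (b ℚ.+ n ℚ.* k) ℚ.* w ≡ b ℚ.* w ℚ.+ k ℚ.* (n ℚ.* w)
    shift = solve 4 (λ b n k w → (b :+ n :* k) :* w := b :* w :+ k :* (n :* w)) refl
    A/N≡B/N+K : A ℚ./ suc m ≡ B ℚ./ suc m ℚ.+ ι K
    A/N≡B/N+K = begin
      A ℚ./ suc m                       ≡⟨ /≡ι*w A ⟩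
      ι A ℚ.* w                         ≡⟨ cong (λ Z → ι Z ℚ.* w) (trans (split A B) (cong (λ Z → B ℤ.+ Z) A-B≡NK)) ⟩
      ι (B ℤ.+ N ℤ.* K) ℚ.* w           ≡⟨ cong (ℚ._* w) (trans (ι-+ B (N ℤ.* K)) (cong (ι B ℚ.+_) (ι-* N K))) ⟩
      (ι B ℚ.+ ι N ℚ.* ι K) ℚ.* w       ≡⟨ shift (ι B) (ι N) (ι K) w ⟩
      ι B ℚ.* w ℚ.+ ι K ℚ.* (ι N ℚ.* w) ≡⟨ cong₂ (λ X Y → X ℚ.+ ι K ℚ.* Y) (sym (/≡ι*w B)) ιN*w≡1 ⟩
      B ℚ./ suc m ℚ.+ ι K ℚ.* 1ℚ        ≡⟨ cong (B ℚ./ suc m ℚ.+_) (ℚP.*-identityʳ (ι K)) ⟩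
      B ℚ./ suc m ℚ.+ ι K               ∎

  squared-length-/N : ∀ e₁ e₂ M → e₁ ℤ.* e₁ ℤ.+ e₂ ℤ.* e₂ ≡ N ℤ.* M →
                      squared-length (ι e₁ ℚ.* w) (ι e₂ ℚ.* w) ≡ ι M ℚ.* w
  squared-length-/N e₁ e₂ M e₁²+e₂²≡NM = begin
    squared-length (ι e₁ ℚ.* w) (ι e₂ ℚ.* w)
      ≡⟨ cong₂ ℚ._+_ (∣p∣*∣p∣≡p*p (ι e₁ ℚ.* w)) (∣p∣*∣p∣≡p*p (ι e₂ ℚ.* w)) ⟩
    (ι e₁ ℚ.* w) ℚ.* (ι e₁ ℚ.* w) ℚ.+ (ι e₂ ℚ.* w) ℚ.* (ι e₂ ℚ.* w)
      ≡⟨ collect (ι e₁) (ι e₂) w ⟩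
    (ι e₁ ℚ.* ι e₁ ℚ.+ ι e₂ ℚ.* ι e₂) ℚ.* w ℚ.* w
      ≡⟨ cong (λ X → X ℚ.* w ℚ.* w) (sym (trans (ι-+ (e₁ ℤ.* e₁) (e₂ ℤ.* e₂)) (cong₂ ℚ._+_ (ι-* e₁ e₁) (ι-* e₂ e₂)))) ⟩
    ι (e₁ ℤ.* e₁ ℤ.+ e₂ ℤ.* e₂) ℚ.* w ℚ.* w
      ≡⟨ cong (λ Z → ι Z ℚ.* w ℚ.* w) e₁²+e₂²≡NM ⟩
    ι (N ℤ.* M) ℚ.* w ℚ.* w
      ≡⟨ cong (λ X → X ℚ.* w ℚ.* w) (ι-* N M) ⟩
    ι N ℚ.* ι M ℚ.* w ℚ.* w
      ≡⟨ reorder (ι N) (ι M) w ⟩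
    ι M ℚ.* (ι N ℚ.* w) ℚ.* w
      ≡⟨ cong (λ X → ι M ℚ.* X ℚ.* w) ιN*w≡1 ⟩
    ι M ℚ.* 1ℚ ℚ.* w
      ≡⟨ cong (ℚ._* w) (ℚP.*-identityʳ (ι M)) ⟩
    ι M ℚ.* w ∎
    where
    open ≡-Reasoning
    ∣p∣*∣p∣≡p*p : ∀ p → ℚ.∣ p ∣ ℚ.* ℚ.∣ p ∣ ≡ p ℚ.* p
    ∣p∣*∣p∣≡p*p p with ℚP.∣p∣≡p∨∣p∣≡-p p
    ... | inj₁ ∣p∣≡p  = cong₂ ℚ._*_ ∣p∣≡p ∣p∣≡p
    ... | inj₂ ∣p∣≡-p = trans (cong₂ ℚ._*_ ∣p∣≡-p ∣p∣≡-p) (solve 1 (λ p → (:- p) :* (:- p) := p :* p) refl p)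
    collect : ∀ a b w → (a ℚ.* w) ℚ.* (a ℚ.* w) ℚ.+ (b ℚ.* w) ℚ.* (b ℚ.* w) ≡ (a ℚ.* a ℚ.+ b ℚ.* b) ℚ.* w ℚ.* w
    collect = solve 3 (λ a b w → (a :* w) :* (a :* w) :+ (b :* w) :* (b :* w) := (a :* a :+ b :* b) :* w :* w) refl
    reorder : ∀ n x w → n ℚ.* x ℚ.* w ℚ.* w ≡ x ℚ.* (n ℚ.* w) ℚ.* w
    reorder = solve 3 (λ n x w → n :* x :* w :* w := x :* (n :* w) :* w) refl

  w≤ιM*w : ∀ M → + 1 ℤ.≤ M → w ℚ.≤ ι M ℚ.* w
  w≤ιM*w M 1≤M = subst (ℚ._≤ ι M ℚ.* w) (ℚP.*-identityˡ w)
    (ℚP.*-monoʳ-≤-nonNeg w {{ℚP.normalize-nonNeg 1 (suc m)}} (ι-mono-≤ 1≤M))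

𝒩≥1 : ∀ z → ¬ (z ≡ 0𝔾) → + 1 ℤ.≤ 𝒩 z
𝒩≥1 z z≢0 with norm z in norm-z
... | zero  = ⊥-elim (z≢0 (norm≡0⇒≡0 z norm-z))
... | suc _ = subst (+ 1 ℤ.≤_) (trans (cong +_ (sym norm-z)) (norm≡𝒩 z)) (ℤ.+≤+ (s≤s z≤n))

numerator-differences : ∀ u v ũ ṽ k l →
  ((u ℤ.* k ℤ.+ v ℤ.* l) ℤ.- (ũ ℤ.* k ℤ.+ ṽ ℤ.* l) ≡ (u ℤ.- ũ) ℤ.* k ℤ.+ (v ℤ.- ṽ) ℤ.* l) ×
  ((ℤ.- v ℤ.* k ℤ.+ u ℤ.* l) ℤ.- (ℤ.- ṽ ℤ.* k ℤ.+ ũ ℤ.* l) ≡ ℤ.- (v ℤ.- ṽ) ℤ.* k ℤ.+ (u ℤ.- ũ) ℤ.* l)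
numerator-differences u v ũ ṽ k l = first u v ũ ṽ k l , second u v ũ ṽ k l
  where
  first : ∀ u v ũ ṽ k l → (u ℤ.* k ℤ.+ v ℤ.* l) ℤ.- (ũ ℤ.* k ℤ.+ ṽ ℤ.* l) ≡ (u ℤ.- ũ) ℤ.* k ℤ.+ (v ℤ.- ṽ) ℤ.* l
  first = solve-∀
  second : ∀ u v ũ ṽ k l → (ℤ.- v ℤ.* k ℤ.+ u ℤ.* l) ℤ.- (ℤ.- ṽ ℤ.* k ℤ.+ ũ ℤ.* l) ≡ ℤ.- (v ℤ.- ṽ) ℤ.* k ℤ.+ (u ℤ.- ũ) ℤ.* l
  second = solve-∀

-- With q = a + b i, r = x + y i, N = 𝒩 q, k = x a + y b and l = x b - y a we have
-- r q̄ = k - l i.  Hence for d = d₁ + d₂ i the numbers d₁ k + d₂ l and -d₂ k + d₁ l are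
-- the coordinates of the conjugate of d r q̄, and multiplicativity of the norm gives,
-- for every t₁, t₂,
error-norm : ∀ a b x y d₁ d₂ t₁ t₂ {N} → a ℤ.* a ℤ.+ b ℤ.* b ≡ N →
  ((d₁ ℤ.* (x ℤ.* a ℤ.+ y ℤ.* b) ℤ.+ d₂ ℤ.* (x ℤ.* b ℤ.- y ℤ.* a)) ℤ.- N ℤ.* t₁) ² ℤ.+
  ((ℤ.- d₂ ℤ.* (x ℤ.* a ℤ.+ y ℤ.* b) ℤ.+ d₁ ℤ.* (x ℤ.* b ℤ.- y ℤ.* a)) ℤ.- N ℤ.* t₂) ²
  ≡ N ℤ.* 𝒩 ((d₁ + d₂ i) *𝔾 (x + y i) -𝔾 (a + b i) *𝔾 (t₁ + (ℤ.- t₂) i))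
error-norm a b x y d₁ d₂ t₁ t₂ refl = identity a b x y d₁ d₂ t₁ t₂
  where
  identity : ∀ a b x y d₁ d₂ t₁ t₂ →
      ((d₁ ℤ.* (x ℤ.* a ℤ.+ y ℤ.* b) ℤ.+ d₂ ℤ.* (x ℤ.* b ℤ.- y ℤ.* a)) ℤ.- (a ℤ.* a ℤ.+ b ℤ.* b) ℤ.* t₁)
        ℤ.* ((d₁ ℤ.* (x ℤ.* a ℤ.+ y ℤ.* b) ℤ.+ d₂ ℤ.* (x ℤ.* b ℤ.- y ℤ.* a)) ℤ.- (a ℤ.* a ℤ.+ b ℤ.* b) ℤ.* t₁)
    ℤ.+ ((ℤ.- d₂ ℤ.* (x ℤ.* a ℤ.+ y ℤ.* b) ℤ.+ d₁ ℤ.* (x ℤ.* b ℤ.- y ℤ.* a)) ℤ.- (a ℤ.* a ℤ.+ b ℤ.* b) ℤ.* t₂)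
        ℤ.* ((ℤ.- d₂ ℤ.* (x ℤ.* a ℤ.+ y ℤ.* b) ℤ.+ d₁ ℤ.* (x ℤ.* b ℤ.- y ℤ.* a)) ℤ.- (a ℤ.* a ℤ.+ b ℤ.* b) ℤ.* t₂)
    ≡ (a ℤ.* a ℤ.+ b ℤ.* b) ℤ.*
      (((d₁ ℤ.* x ℤ.- d₂ ℤ.* y) ℤ.- (a ℤ.* t₁ ℤ.- b ℤ.* (ℤ.- t₂)))
         ℤ.* ((d₁ ℤ.* x ℤ.- d₂ ℤ.* y) ℤ.- (a ℤ.* t₁ ℤ.- b ℤ.* (ℤ.- t₂)))
       ℤ.+ ((d₁ ℤ.* y ℤ.+ d₂ ℤ.* x) ℤ.- (a ℤ.* (ℤ.- t₂) ℤ.+ b ℤ.* t₁))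
         ℤ.* ((d₁ ℤ.* y ℤ.+ d₂ ℤ.* x) ℤ.- (a ℤ.* (ℤ.- t₂) ℤ.+ b ℤ.* t₁)))
  identity = solve-∀

-- If d = q c then d r q̄ = N c r, so both coordinates are multiples of N.
multiple-differences : ∀ a b x y c₁ c₂ {N} → a ℤ.* a ℤ.+ b ℤ.* b ≡ N →
  ((a ℤ.* c₁ ℤ.- b ℤ.* c₂) ℤ.* (x ℤ.* a ℤ.+ y ℤ.* b) ℤ.+ (a ℤ.* c₂ ℤ.+ b ℤ.* c₁) ℤ.* (x ℤ.* b ℤ.- y ℤ.* a)
     ≡ N ℤ.* (x ℤ.* c₁ ℤ.- y ℤ.* c₂)) ×
  (ℤ.- (a ℤ.* c₂ ℤ.+ b ℤ.* c₁) ℤ.* (x ℤ.* a ℤ.+ y ℤ.* b) ℤ.+ (a ℤ.* c₁ ℤ.- b ℤ.* c₂) ℤ.* (x ℤ.* b ℤ.- y ℤ.* a)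
     ≡ N ℤ.* ℤ.- (x ℤ.* c₂ ℤ.+ y ℤ.* c₁))
multiple-differences a b x y c₁ c₂ refl = first a b x y c₁ c₂ , second a b x y c₁ c₂
  where
  first : ∀ a b x y c₁ c₂ →
    (a ℤ.* c₁ ℤ.- b ℤ.* c₂) ℤ.* (x ℤ.* a ℤ.+ y ℤ.* b) ℤ.+ (a ℤ.* c₂ ℤ.+ b ℤ.* c₁) ℤ.* (x ℤ.* b ℤ.- y ℤ.* a)
      ≡ (a ℤ.* a ℤ.+ b ℤ.* b) ℤ.* (x ℤ.* c₁ ℤ.- y ℤ.* c₂)
  first = solve-∀
  second : ∀ a b x y c₁ c₂ →
    ℤ.- (a ℤ.* c₂ ℤ.+ b ℤ.* c₁) ℤ.* (x ℤ.* a ℤ.+ y ℤ.* b) ℤ.+ (a ℤ.* c₁ ℤ.- b ℤ.* c₂) ℤ.* (x ℤ.* b ℤ.- y ℤ.* a)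
      ≡ (a ℤ.* a ℤ.+ b ℤ.* b) ℤ.* ℤ.- (x ℤ.* c₂ ℤ.+ y ℤ.* c₁)
  second = solve-∀

-- The two halves of the theorem for a fixed norm N = 𝒩 q = m + 1, stated for arbitrary
-- numerators whose differences are the coordinates of the conjugate of d r q̄.
module Theorem (m : ℕ) (a b x y : ℤ) (𝒩q≡N : a ℤ.* a ℤ.+ b ℤ.* b ≡ + suc m)
               (r⊥q : Coprime𝔾 (x + y i) (a + b i)) where
  open Denominator m

  q r : 𝔾
  q = a + b i
  r = x + y i

  k l : ℤ
  k = x ℤ.* a ℤ.+ y ℤ.* b
  l = x ℤ.* b ℤ.- y ℤ.* a

  Distance : ℤ → ℤ → ℤ → ℤ → ℚ
  Distance A₁ B₁ A₂ B₂ = squared-length (f (A₁ ℚ./ suc m) ℚ.- f (B₁ ℚ./ suc m))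
                                        (f (A₂ ℚ./ suc m) ℚ.- f (B₂ ℚ./ suc m))

  -- If q ∤ d, the distance is 𝒩 (d r - q t) / N ≥ 1 / N, t collecting the roundings.
  far : ∀ d₁ d₂ A₁ B₁ A₂ B₂ →
        A₁ ℤ.- B₁ ≡ d₁ ℤ.* k ℤ.+ d₂ ℤ.* l → A₂ ℤ.- B₂ ≡ ℤ.- d₂ ℤ.* k ℤ.+ d₁ ℤ.* l →
        ¬ (q ∣𝔾 (d₁ + d₂ i)) → w ℚ.≤ Distance A₁ B₁ A₂ B₂
  far d₁ d₂ A₁ B₁ A₂ B₂ δ₁ δ₂ q∤d = subst (w ℚ.≤_) (sym distance≡) (w≤ιM*w (𝒩 D) (𝒩≥1 D D≢0))
    where
    rounding₁ = f-difference A₁ B₁ (d₁ ℤ.* k ℤ.+ d₂ ℤ.* l) δ₁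
    rounding₂ = f-difference A₂ B₂ (ℤ.- d₂ ℤ.* k ℤ.+ d₁ ℤ.* l) δ₂
    t : 𝔾
    t = proj₁ rounding₁ + (ℤ.- proj₁ rounding₂) i
    D : 𝔾
    D = (d₁ + d₂ i) *𝔾 r -𝔾 q *𝔾 t
    -- D = 0 would give q ∣ d r, hence q ∣ d by Euclid's lemma
    D≢0 : ¬ (D ≡ 0𝔾)
    D≢0 D≡0 = q∤d (euclid q r (d₁ + d₂ i) r⊥q (t , x-y≡0⇒y≡x _ _ D≡0))
    distance≡ : Distance A₁ B₁ A₂ B₂ ≡ ι (𝒩 D) ℚ.* w
    distance≡ = trans (cong₂ squared-length (proj₂ rounding₁) (proj₂ rounding₂))
      (squared-length-/N ((d₁ ℤ.* k ℤ.+ d₂ ℤ.* l) ℤ.- N ℤ.* proj₁ rounding₁)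
                         ((ℤ.- d₂ ℤ.* k ℤ.+ d₁ ℤ.* l) ℤ.- N ℤ.* proj₁ rounding₂) (𝒩 D)
                         (error-norm a b x y d₁ d₂ (proj₁ rounding₁) (proj₁ rounding₂) 𝒩q≡N))

  -- If q ∣ d, the numerators are pairwise congruent modulo N, so the distance vanishes.
  near : ∀ d₁ d₂ A₁ B₁ A₂ B₂ →
         A₁ ℤ.- B₁ ≡ d₁ ℤ.* k ℤ.+ d₂ ℤ.* l → A₂ ℤ.- B₂ ≡ ℤ.- d₂ ℤ.* k ℤ.+ d₁ ℤ.* l →
         q ∣𝔾 (d₁ + d₂ i) → Distance A₁ B₁ A₂ B₂ ≡ 0ℚ
  near _ _ A₁ B₁ A₂ B₂ δ₁ δ₂ (c₁ + c₂ i , refl) = begin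
    Distance A₁ B₁ A₂ B₂
      ≡⟨ cong₂ (λ X Y → squared-length (X ℚ.- f (B₁ ℚ./ suc m)) (Y ℚ.- f (B₂ ℚ./ suc m)))
               (f-congruent A₁ B₁ _ (trans δ₁ multiple₁)) (f-congruent A₂ B₂ _ (trans δ₂ multiple₂)) ⟩
    squared-length (f (B₁ ℚ./ suc m) ℚ.- f (B₁ ℚ./ suc m)) (f (B₂ ℚ./ suc m) ℚ.- f (B₂ ℚ./ suc m))
      ≡⟨ cong₂ squared-length (ℚP.+-inverseʳ (f (B₁ ℚ./ suc m))) (ℚP.+-inverseʳ (f (B₂ ℚ./ suc m))) ⟩
    squared-length 0ℚ 0ℚ
      ≡⟨⟩
    0ℚ ∎
    where
    open ≡-Reasoning
    multiples = multiple-differences a b x y c₁ c₂ 𝒩q≡N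
    multiple₁ = proj₁ multiples
    multiple₂ = proj₂ multiples

-- The statement of the theorem, with ∣𝒩 q₂∣ replaced by a natural number n.
Conclusion : (u₂ v₂ x₂ y₂ u v ũ ṽ : ℤ) → ℕ → Set
Conclusion u₂ v₂ x₂ y₂ u v ũ ṽ n =
  let q₂ = u₂ + v₂ i
      k = x₂ ℤ.* u₂ ℤ.+ y₂ ℤ.* v₂
      l = x₂ ℤ.* v₂ ℤ.- y₂ ℤ.* u₂
      A = ℚ.∣ f ((u ℤ.* k ℤ.+ v ℤ.* l) /ℕ n) ℚ.- f ((ũ ℤ.* k ℤ.+ ṽ ℤ.* l) /ℕ n) ∣
      B = ℚ.∣ f ((ℤ.- v ℤ.* k ℤ.+ u ℤ.* l) /ℕ n) ℚ.- f ((ℤ.- ṽ ℤ.* k ℤ.+ ũ ℤ.* l) /ℕ n) ∣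
      S = A ℚ.* A ℚ.+ B ℚ.* B
      d = (u ℤ.- ũ) + (v ℤ.- ṽ) i
  in (¬ (q₂ ∣𝔾 d) → (+ 1) /ℕ n ℚ.≤ S) × (q₂ ∣𝔾 d → S ≡ 0ℚ)

conclusion : ∀ u₂ v₂ x₂ y₂ → ¬ ((u₂ + v₂ i) ≡ 0𝔾) → Coprime𝔾 (x₂ + y₂ i) (u₂ + v₂ i) →
             ∀ u v ũ ṽ n → ℤ.∣ 𝒩 (u₂ + v₂ i) ∣ ≡ n → Conclusion u₂ v₂ x₂ y₂ u v ũ ṽ n
conclusion u₂ v₂ x₂ y₂ q≢0 r⊥q u v ũ ṽ zero ∣𝒩q∣≡0 =
  ⊥-elim (q≢0 (norm≡0⇒≡0 (u₂ + v₂ i) (trans (sym (∣𝒩∣≡norm (u₂ + v₂ i))) ∣𝒩q∣≡0)))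
conclusion u₂ v₂ x₂ y₂ q≢0 r⊥q u v ũ ṽ (suc m) ∣𝒩q∣≡n =
  far  (u ℤ.- ũ) (v ℤ.- ṽ) A₁ B₁ A₂ B₂ δ₁ δ₂ ,
  near (u ℤ.- ũ) (v ℤ.- ṽ) A₁ B₁ A₂ B₂ δ₁ δ₂
  where
  𝒩q≡N : 𝒩 (u₂ + v₂ i) ≡ + suc m
  𝒩q≡N = trans (sym (norm≡𝒩 (u₂ + v₂ i))) (cong +_ (trans (sym (∣𝒩∣≡norm (u₂ + v₂ i))) ∣𝒩q∣≡n))
  open Theorem m u₂ v₂ x₂ y₂ 𝒩q≡N r⊥q
  A₁ = u ℤ.* k ℤ.+ v ℤ.* l
  B₁ = ũ ℤ.* k ℤ.+ ṽ ℤ.* l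
  A₂ = ℤ.- v ℤ.* k ℤ.+ u ℤ.* l
  B₂ = ℤ.- ṽ ℤ.* k ℤ.+ ũ ℤ.* l
  δ₁ = proj₁ (numerator-differences u v ũ ṽ k l)
  δ₂ = proj₂ (numerator-differences u v ũ ṽ k l)

lemma2 : (u₂ v₂ x₂ y₂ : ℤ) → ¬ ((u₂ + v₂ i) ≡ 0𝔾) → Coprime𝔾 (x₂ + y₂ i) (u₂ + v₂ i) →
    let q₂ = u₂ + v₂ i
        k = x₂ ℤ.* u₂ ℤ.+ y₂ ℤ.* v₂
        l = x₂ ℤ.* v₂ ℤ.- y₂ ℤ.* u₂
    in (u v ũ ṽ : ℤ) →
    let A = ℚ.∣ f ((u ℤ.* k ℤ.+ v ℤ.* l) /𝒩 q₂) ℚ.- f ((ũ ℤ.* k ℤ.+ ṽ ℤ.* l) /𝒩 q₂) ∣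
        B = ℚ.∣ f ((ℤ.- v ℤ.* k ℤ.+ u ℤ.* l) /𝒩 q₂) ℚ.- f ((ℤ.- ṽ ℤ.* k ℤ.+ ũ ℤ.* l) /𝒩 q₂) ∣
        S = A ℚ.* A ℚ.+ B ℚ.* B
        d = (u ℤ.- ũ) + (v ℤ.- ṽ) i
    in (¬ (q₂ ∣𝔾 d) → (+ 1) /𝒩 q₂ ℚ.≤ S) × (q₂ ∣𝔾 d → S ≡ 0ℚ)
lemma2 u₂ v₂ x₂ y₂ q≢0 r⊥q u v ũ ṽ =
  conclusion u₂ v₂ x₂ y₂ q≢0 r⊥q u v ũ ṽ (ℤ.∣ 𝒩 (u₂ + v₂ i) ∣) refl
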